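{- Let $x,y,z\ge4$ be integers with $x+y+z=n+5$, and let $I=[x-1,y,z-4:\varnothing]\in\mathcal{IC}([2]\times[n])$. Then (1) $\mathrm{Row}^z(I)=[z-1,x,y-4:\varnothing]$, and (2) none of the $z-1$ intermediate ICS $\mathrm{Row}^k(I)$, $1\le k\le z-1$, is a Low ICS.
   Context: $[2]\times[n]=\{(i,j): i\in\{1,2\},1\le j\le n\}$ with the componentwise order; the lower chain is $\{1\}\times[n]$. An interval-closed set (ICS) is a subset $I$ with $x,y\in I$, $x\le z\le y\Rightarrow z\in I$. The toggle $t_x$ sends $I$ to $I\triangle\{x\}$ if this is an ICS, and to $I$ otherwise; rowmotion is $\mathrm{Row}=t_{x_1}\circ\cdots\circ t_{x_N}$ for any linear extension $x_1,\dots,x_N$ (toggles applied top to bottom). For nonnegative $b+i+a=n$, $[b,i,a:\varnothing]$ denotes $\{(1,j): b<j\le b+i\}$. A Low ICS is a nonempty ICS contained in the lower chain. -}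

module Defs where

open import Data.Nat using (ℕ; zero; suc; _+_; _<ᵇ_; _≤ᵇ_)
open import Data.Fin using (Fin; zero; suc; toℕ)
open import Data.Bool using (Bool; true; false; _∧_; _∨_; not; if_then_else_; T)
open import Data.List using (List; []; _∷_; allFin; _++_; map; foldr)
open import Data.Bool.ListAction using (all)
open import Data.Product using (Σ; _×_; _,_)
open import Relation.Binary.PropositionalEquality using (_≡_)
open import Function using (_∘_; id)

-- Elements of the poset [2]×[n]: (i , j) with i ∈ Fin 2, j ∈ Fin n.
-- Fin 2 index 0 is the paper's 1 (lower chain), index 1 is the paper's 2;
-- Fin n index j is the paper's j+1.
Elt : ℕ → Set
Elt n = Fin 2 × Fin n

_≤P_ : {n : ℕ} → Elt n → Elt n → Bool
(i , j) ≤P (i' , j') = (toℕ i ≤ᵇ toℕ i') ∧ (toℕ j ≤ᵇ toℕ j')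

Subset : ℕ → Set
Subset n = Elt n → Bool

elts : (n : ℕ) → List (Elt n)
elts n = foldr (λ i acc → map (λ j → (i , j)) (allFin n) ++ acc) [] (allFin 2)

isICS : {n : ℕ} → Subset n → Bool
isICS {n} I =
  all (λ x → all (λ y → all (λ z →
    not (I x ∧ I y ∧ (x ≤P z) ∧ (z ≤P y)) ∨ I z) (elts n)) (elts n)) (elts n)

IsICS : {n : ℕ} → Subset n → Set
IsICS I = T (isICS I)

_≟E_ : {n : ℕ} → Elt n → Elt n → Bool
(i , j) ≟E (i' , j') = (toℕ i Data.Nat.≡ᵇ toℕ i') ∧ (toℕ j Data.Nat.≡ᵇ toℕ j')

flipAt : {n : ℕ} → Elt n → Subset n → Subset n
flipAt x I y = if x ≟E y then not (I y) else I y

toggle : {n : ℕ} → Elt n → Subset n → Subset n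
toggle x I = if isICS (flipAt x I) then flipAt x I else I

-- the fixed linear extension x_1,...,x_N: the lower chain (1,1),...,(1,n)
-- followed by the upper chain (2,1),...,(2,n)
linExt : (n : ℕ) → List (Elt n)
linExt n = elts n

-- Row = t_{x_1} ∘ ... ∘ t_{x_N}  (t_{x_N} applied first)
Row : {n : ℕ} → Subset n → Subset n
Row {n} = foldr (λ x f → toggle x ∘ f) id (linExt n)

iterate : {A : Set} → ℕ → (A → A) → A → A
iterate zero f a = a
iterate (suc k) f a = f (iterate k f a)

-- [b,i,a:∅] = {(1,j) : b < j ≤ b+i}   (a = n - b - i is implicit)
segment : {n : ℕ} → ℕ → ℕ → Subset n
segment b i (zero , j) = (b <ᵇ suc (toℕ j)) ∧ (suc (toℕ j) ≤ᵇ b + i)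
segment b i (suc _ , j) = false

LowICS : {n : ℕ} → Subset n → Set
LowICS {n} I = IsICS I × Σ (Elt n) (λ x → T (I x)) × ((j : Fin n) → I (suc zero , j) ≡ false)

-- Rowmotion is the sweep of toggles down the upper row followed by the sweep down the lower row.
-- Every set on the orbit has at most one interval in each row; on such a set a toggle succeeds only
-- at an end of an interval, and only if the two rows stay compatible (apart, or in staircase
-- position).  So each Row step can be computed explicitly: after one step the upper row is [0, x),
-- both rows then move up one position per step until, after z − 3 steps, only the upper row
-- [z − 4, z − 4 + x) is left, and three more steps bring it back to the lower chain as
-- [z − 1, z − 1 + x).  Every intermediate set has a nonempty upper row, so none of them is Low.

module Submission where

open import Defs
open import Data.Nat using (ℕ; _+_; _∸_; _≤_)
open import Data.Fin using (Fin)
open import Data.Product using (_×_)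
open import Relation.Binary.PropositionalEquality using (_≡_)
open import Relation.Nullary using (¬_)

open import Data.Bool using (Bool; true; false; _∧_; _∨_; not; if_then_else_; T)
open import Data.Bool.Properties using (T-≡; T-∧; T-∨; T-not-≡; not-¬)
open import Data.Bool.ListAction using (all)
open import Data.Empty using (⊥-elim)
open import Data.Fin using (zero; suc; toℕ; fromℕ<)
open import Data.Fin.Properties using (toℕ-fromℕ<)
open import Data.List using (List; []; _∷_; _++_; map; foldr; allFin; tabulate)
open import Data.List.Properties using (map-tabulate; tabulate-cong; ++-identityʳ)
open import Data.List.Membership.Propositional using (_∈_)
open import Data.List.Membership.Propositional.Properties using (∈-++⁺ˡ; ∈-++⁺ʳ; ∈-map⁺; ∈-allFin)
open import Data.List.Relation.Unary.All using (lookup; universal)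
open import Data.List.Relation.Unary.All.Properties using (all⁺; all⁻)
open import Data.Nat using (zero; suc; _<_; _≤ᵇ_; _<ᵇ_; _≡ᵇ_; z≤n; s≤s; s≤s⁻¹; z<s; _≟_)
open import Data.Nat.Properties
open import Data.Nat.Tactic.RingSolver using (solve-∀)
open import Data.Product using (_,_; proj₁; proj₂)
open import Data.Sum using (_⊎_; inj₁; inj₂)
open import Function using (_∘_; id; Equivalence)
open import Relation.Binary.PropositionalEquality using (refl; sym; trans; cong; cong₂; subst; _≗_; _≢_; module ≡-Reasoning)
open import Relation.Nullary using (yes; no)

T⇒≡true : ∀ {b} → T b → b ≡ true
T⇒≡true = Equivalence.to T-≡

≡true⇒T : ∀ {b} → b ≡ true → T b
≡true⇒T = Equivalence.from T-≡

T-∧-intro : ∀ {a b} → T a → T b → T (a ∧ b)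
T-∧-intro ta tb = Equivalence.from T-∧ (ta , tb)

T-ext : ∀ {a b} → (T a → T b) → (T b → T a) → a ≡ b
T-ext {false} {false} _ _  = refl
T-ext {false} {true}  _ ba = ⊥-elim (ba _)
T-ext {true}  {false} ab _ = ⊥-elim (ab _)
T-ext {true}  {true}  _ _  = refl

≡ᵇ-refl : ∀ j → (j ≡ᵇ j) ≡ true
≡ᵇ-refl j = T⇒≡true (≡⇒≡ᵇ j j refl)

≢⇒≡ᵇ-false : ∀ {i j} → i ≢ j → (i ≡ᵇ j) ≡ false
≢⇒≡ᵇ-false {i} {j} i≢j = T-ext (λ t → ⊥-elim (i≢j (≡ᵇ⇒≡ i j t))) λ ()

-- [_,_⟩ and flipRow are opaque so that unification can recover their arguments.
opaque
  [_,_⟩ : ℕ → ℕ → ℕ → Bool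
  [ p , q ⟩ j = (p ≤ᵇ j) ∧ (j <ᵇ q)

  [,⟩-intro : ∀ {p q j} → p ≤ j × j < q → T ([ p , q ⟩ j)
  [,⟩-intro (p≤j , j<q) = T-∧-intro (≤⇒≤ᵇ p≤j) (<⇒<ᵇ j<q)

  [,⟩-elim : ∀ {p q j} → T ([ p , q ⟩ j) → p ≤ j × j < q
  [,⟩-elim {p} {q} {j} t with Equivalence.to (T-∧ {p ≤ᵇ j}) t
  ... | p≤j , j<q = ≤ᵇ⇒≤ p j p≤j , <ᵇ⇒< j q j<q

[,⟩-in : ∀ {p q j} → p ≤ j → j < q → [ p , q ⟩ j ≡ true
[,⟩-in p≤j j<q = T⇒≡true ([,⟩-intro (p≤j , j<q))

[,⟩-out : ∀ {p q j} → ¬ (p ≤ j × j < q) → [ p , q ⟩ j ≡ false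
[,⟩-out out = T-ext (λ t → ⊥-elim (out ([,⟩-elim t))) λ ()

[,⟩-below : ∀ {p q j} → j < p → [ p , q ⟩ j ≡ false
[,⟩-below j<p = [,⟩-out λ (p≤j , _) → <⇒≱ j<p p≤j

[,⟩-above : ∀ {p q j} → q ≤ j → [ p , q ⟩ j ≡ false
[,⟩-above q≤j = [,⟩-out λ (_ , j<q) → <⇒≱ j<q q≤j

[,⟩-empty : ∀ {p q j} → q ≤ p → [ p , q ⟩ j ≡ false
[,⟩-empty q≤p = [,⟩-out λ (p≤j , j<q) → <⇒≱ j<q (≤-trans q≤p p≤j)

[,⟩-ext : ∀ {p q p′ q′ j} → (p ≤ j × j < q → p′ ≤ j × j < q′) → (p′ ≤ j × j < q′ → p ≤ j × j < q) →
          [ p , q ⟩ j ≡ [ p′ , q′ ⟩ j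
[,⟩-ext to from = T-ext ([,⟩-intro ∘ to ∘ [,⟩-elim) ([,⟩-intro ∘ from ∘ [,⟩-elim)

[,⟩-convex : ∀ {p q a b c} → T ([ p , q ⟩ a) → T ([ p , q ⟩ b) → a ≤ c → c ≤ b → T ([ p , q ⟩ c)
[,⟩-convex a∈ b∈ a≤c c≤b =
  [,⟩-intro (≤-trans (proj₁ ([,⟩-elim a∈)) a≤c , ≤-<-trans c≤b (proj₂ ([,⟩-elim b∈)))

opaque
  flipRow : ℕ → (ℕ → Bool) → ℕ → Bool
  flipRow j f j′ = if j ≡ᵇ j′ then not (f j′) else f j′

  flipRow-at : ∀ j f → flipRow j f j ≡ not (f j)
  flipRow-at j f rewrite ≡ᵇ-refl j = refl

  flipRow-off : ∀ {j j′} f → j ≢ j′ → flipRow j f j′ ≡ f j′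
  flipRow-off f j≢j′ rewrite ≢⇒≡ᵇ-false j≢j′ = refl

flipRow-char : ∀ {j} {f g : ℕ → Bool} → not (f j) ≡ g j → (∀ {j′} → j ≢ j′ → f j′ ≡ g j′) →
               flipRow j f ≗ g
flipRow-char {j} {f} at off j′ with j ≟ j′
... | yes refl = trans (flipRow-at j f) at
... | no j≢j′  = trans (flipRow-off f j≢j′) (off j≢j′)

flip-extendBottom : ∀ {j q} → j < q → flipRow j [ suc j , q ⟩ ≗ [ j , q ⟩
flip-extendBottom {j} j<q = flipRow-char
  (trans (cong not ([,⟩-below (n<1+n j))) (sym ([,⟩-in ≤-refl j<q)))
  (λ j≢j′ → [,⟩-ext (λ (j<j′ , j′<q) → <⇒≤ j<j′ , j′<q)
                     (λ (j≤j′ , j′<q) → ≤∧≢⇒< j≤j′ j≢j′ , j′<q))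

flip-extendTop : ∀ {p j} → p ≤ j → flipRow j [ p , j ⟩ ≗ [ p , suc j ⟩
flip-extendTop {j = j} p≤j = flipRow-char
  (trans (cong not ([,⟩-above ≤-refl)) (sym ([,⟩-in p≤j (n<1+n j))))
  (λ j≢j′ → [,⟩-ext (λ (p≤j′ , j′<j) → p≤j′ , m<n⇒m<1+n j′<j)
                     (λ (p≤j′ , j′≤j) → p≤j′ , ≤∧≢⇒< (s≤s⁻¹ j′≤j) (j≢j′ ∘ sym)))

flip-shrinkBottom : ∀ {j q} → j < q → flipRow j [ j , q ⟩ ≗ [ suc j , q ⟩
flip-shrinkBottom {j} j<q = flipRow-char
  (trans (cong not ([,⟩-in ≤-refl j<q)) (sym ([,⟩-below (n<1+n j))))
  (λ j≢j′ → [,⟩-ext (λ (j≤j′ , j′<q) → ≤∧≢⇒< j≤j′ j≢j′ , j′<q)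
                     (λ (j<j′ , j′<q) → <⇒≤ j<j′ , j′<q))

flip-shrinkTop : ∀ {p j} → p ≤ j → flipRow j [ p , suc j ⟩ ≗ [ p , j ⟩
flip-shrinkTop {j = j} p≤j = flipRow-char
  (trans (cong not ([,⟩-in p≤j (n<1+n j))) (sym ([,⟩-above ≤-refl)))
  (λ j≢j′ → [,⟩-ext (λ (p≤j′ , j′≤j) → p≤j′ , ≤∧≢⇒< (s≤s⁻¹ j′≤j) (j≢j′ ∘ sym))
                     (λ (p≤j′ , j′<j) → p≤j′ , m<n⇒m<1+n j′<j))

flip-empty : ∀ {j p} → flipRow j [ p , p ⟩ ≗ [ j , suc j ⟩
flip-empty {j} = flipRow-char
  (trans (cong not ([,⟩-empty ≤-refl)) (sym ([,⟩-in ≤-refl (n<1+n j))))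
  (λ j≢j′ → trans ([,⟩-empty ≤-refl)
                   (sym ([,⟩-out λ (j≤j′ , j′≤j) → j≢j′ (≤-antisym j≤j′ (s≤s⁻¹ j′≤j)))))

-- Interval-closed sets of [2]×[n]

T-all-∈ : ∀ {A : Set} {p : A → Bool} {xs x} → T (all p xs) → x ∈ xs → T (p x)
T-all-∈ t = lookup (all⁺ _ _ t)

∈-elts : ∀ {n} (e : Elt n) → e ∈ elts n
∈-elts (zero , j) = ∈-++⁺ˡ (∈-map⁺ (zero ,_) (∈-allFin j))
∈-elts {n} (suc zero , j) = ∈-++⁺ʳ (map (zero ,_) (allFin n)) (∈-++⁺ˡ (∈-map⁺ (suc zero ,_) (∈-allFin j)))

isICS-intro : ∀ {n} (I : Subset n) →
              (∀ x y z → T (I x) → T (I y) → T (x ≤P z) → T (z ≤P y) → T (I z)) → IsICS I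
isICS-intro {n} I closed =
  all⁻ _ (universal (λ x → all⁻ _ (universal (λ y → all⁻ _ (universal (clause x y) (elts n))) (elts n))) (elts n))
  where
  clause : ∀ x y z → T (not (I x ∧ I y ∧ (x ≤P z) ∧ (z ≤P y)) ∨ I z)
  clause x y z with I x in ix | I y in iy | x ≤P z in xz | z ≤P y in zy
  ... | false | _     | _     | _     = _
  ... | true  | false | _     | _     = _
  ... | true  | true  | false | _     = _
  ... | true  | true  | true  | false = _
  ... | true  | true  | true  | true  = closed x y z (≡true⇒T ix) (≡true⇒T iy) (≡true⇒T xz) (≡true⇒T zy)

isICS-elim : ∀ {n} (I : Subset n) → IsICS I →
             ∀ x y z → T (I x) → T (I y) → T (x ≤P z) → T (z ≤P y) → T (I z)
isICS-elim I ics x y z Ix Iy x≤z z≤y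
  with Equivalence.to T-∨ (T-all-∈ (T-all-∈ (T-all-∈ ics (∈-elts x)) (∈-elts y)) (∈-elts z))
... | inj₂ Iz   = Iz
... | inj₁ ¬hyp = ⊥-elim (subst T (Equivalence.to T-not-≡ ¬hyp) (T-∧-intro Ix (T-∧-intro Iy (T-∧-intro x≤z z≤y))))

isICS-resp : ∀ {n} {I J : Subset n} → I ≗ J → IsICS I → IsICS J
isICS-resp {I = I} {J} I≗J ics = isICS-intro J λ x y z Jx Jy x≤z z≤y →
  subst T (I≗J z) (isICS-elim I ics x y z (subst T (sym (I≗J x)) Jx) (subst T (sym (I≗J y)) Jy) x≤z z≤y)

isICS-cong : ∀ {n} {I J : Subset n} → I ≗ J → isICS I ≡ isICS J
isICS-cong I≗J = T-ext (isICS-resp I≗J) (isICS-resp (sym ∘ I≗J))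

≤P-fromℕ< : ∀ {n} (i i′ : Fin 2) {j j′} (p : j < n) (p′ : j′ < n) → toℕ i ≤ toℕ i′ → j ≤ j′ →
            T ((i , fromℕ< p) ≤P (i′ , fromℕ< p′))
≤P-fromℕ< _ _ p p′ i≤i′ j≤j′ rewrite toℕ-fromℕ< p | toℕ-fromℕ< p′ =
  T-∧-intro (≤⇒≤ᵇ i≤i′) (≤⇒≤ᵇ j≤j′)

RowOf : ∀ {n} → Subset n → Fin 2 → (ℕ → Bool) → Set
RowOf I i g = ∀ j → I (i , j) ≡ g (toℕ j)

isICS-elimℕ : ∀ {n} (I : Subset n) (ra rb rc : Fin 2) {ga gb gc ja jb jc} → IsICS I →
              RowOf I ra ga → RowOf I rb gb → RowOf I rc gc →
              jb < n → toℕ ra ≤ toℕ rc → toℕ rc ≤ toℕ rb → ja ≤ jc → jc ≤ jb →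
              ga ja ≡ true → gb jb ≡ true → gc jc ≡ true
isICS-elimℕ {n} I ra rb rc {ja = ja} {jb} {jc} ics rowa rowb rowc jb<n ra≤rc rc≤rb ja≤jc jc≤jb gaja gbjb =
  trans (sym (at rc rowc jc<n)) (T⇒≡true (isICS-elim I ics (ra , fromℕ< ja<n) (rb , fromℕ< jb<n) (rc , fromℕ< jc<n)
    (≡true⇒T (trans (at ra rowa ja<n) gaja)) (≡true⇒T (trans (at rb rowb jb<n) gbjb))
    (≤P-fromℕ< ra rc ja<n jc<n ra≤rc ja≤jc) (≤P-fromℕ< rc rb jc<n jb<n rc≤rb jc≤jb)))
  where
  jc<n : jc < n
  jc<n = ≤-<-trans jc≤jb jb<n
  ja<n : ja < n
  ja<n = ≤-<-trans ja≤jc jc<n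
  at : ∀ r {g j} → RowOf I r g → (p : j < n) → I (r , fromℕ< p) ≡ g j
  at r {g} row p = trans (row _) (cong g (toℕ-fromℕ< p))

RowConvex : ℕ → (ℕ → Bool) → Set
RowConvex n g = ∀ {a b c} → b < n → a ≤ c → c ≤ b → g a ≡ true → g b ≡ true → g c ≡ true

isICS⇒rowConvex : ∀ {n} (I : Subset n) i {g} → IsICS I → RowOf I i g → RowConvex n g
isICS⇒rowConvex I i ics row b<n a≤c c≤b = isICS-elimℕ I i i i ics row row row b<n ≤-refl ≤-refl a≤c c≤b

isICS⇒cross : ∀ {n} (I : Subset n) {lo up a b} → IsICS I → RowOf I zero lo → RowOf I (suc zero) up →
              b < n → a ≤ b → lo a ≡ true → up b ≡ true → up a ≡ true × lo b ≡ true
isICS⇒cross I ics lower upper b<n a≤b loa upb =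
  isICS-elimℕ I zero (suc zero) (suc zero) ics lower upper upper b<n z≤n ≤-refl ≤-refl a≤b loa upb ,
  isICS-elimℕ I zero (suc zero) zero ics lower upper lower b<n ≤-refl z≤n a≤b ≤-refl loa upb

-- Rowmotion as two row sweeps

flipℕ : ∀ {n} → Fin 2 → ℕ → Subset n → Subset n
flipℕ i j I e = if (toℕ i ≡ᵇ toℕ (proj₁ e)) ∧ (j ≡ᵇ toℕ (proj₂ e)) then not (I e) else I e

toggleℕ : ∀ {n} → Fin 2 → ℕ → Subset n → Subset n
toggleℕ i j I = if isICS (flipℕ i j I) then flipℕ i j I else I

flipℕ-cong : ∀ {n} i j {I J : Subset n} → I ≗ J → flipℕ i j I ≗ flipℕ i j J
flipℕ-cong i j I≗J e rewrite I≗J e = refl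

toggleℕ-cong : ∀ {n} i j {I J : Subset n} → I ≗ J → toggleℕ i j I ≗ toggleℕ i j J
toggleℕ-cong i j {J = J} I≗J e rewrite isICS-cong (flipℕ-cong i j I≗J) with isICS (flipℕ i j J)
... | true  = flipℕ-cong i j I≗J e
... | false = I≗J e

toggleℕ-blocked : ∀ {n} i j {I : Subset n} → ¬ IsICS (flipℕ i j I) → toggleℕ i j I ≗ I
toggleℕ-blocked i j {I} ¬ics e with isICS (flipℕ i j I)
... | true  = ⊥-elim (¬ics _)
... | false = refl

toggleℕ-applies : ∀ {n} i j {I J : Subset n} → flipℕ i j I ≗ J → IsICS J → toggleℕ i j I ≗ J
toggleℕ-applies i j I≗J ics rewrite isICS-cong I≗J | T⇒≡true ics = I≗J

sweepFrom : ∀ {n} → Fin 2 → ℕ → ℕ → Subset n → Subset n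
sweepFrom i lo zero    = id
sweepFrom i lo (suc m) = toggleℕ i lo ∘ sweepFrom i (suc lo) m

sweep : ∀ {n} → Fin 2 → ℕ → ℕ → Subset n → Subset n
sweep i lo hi = sweepFrom i lo (hi ∸ lo)

sweepFrom-cong : ∀ {n} i lo m {I J : Subset n} → I ≗ J → sweepFrom i lo m I ≗ sweepFrom i lo m J
sweepFrom-cong i lo zero    I≗J = I≗J
sweepFrom-cong i lo (suc m) I≗J = toggleℕ-cong i lo (sweepFrom-cong i (suc lo) m I≗J)

sweepFrom-+ : ∀ {n} i lo m₁ m₂ (I : Subset n) →
              sweepFrom i lo (m₁ + m₂) I ≡ sweepFrom i lo m₁ (sweepFrom i (lo + m₁) m₂ I)
sweepFrom-+ i lo zero     m₂ I rewrite +-identityʳ lo = refl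
sweepFrom-+ i lo (suc m₁) m₂ I rewrite +-suc lo m₁ = cong (toggleℕ i lo) (sweepFrom-+ i (suc lo) m₁ m₂ I)

sweep-split : ∀ {n} i {lo mid hi} (I : Subset n) → lo ≤ mid → mid ≤ hi →
              sweep i lo hi I ≡ sweep i lo mid (sweep i mid hi I)
sweep-split i {lo} {mid} {hi} I lo≤mid mid≤hi = begin
  sweepFrom i lo (hi ∸ lo) I
    ≡⟨ cong (λ m → sweepFrom i lo m I) (sym ∸-split) ⟩
  sweepFrom i lo ((mid ∸ lo) + (hi ∸ mid)) I
    ≡⟨ sweepFrom-+ i lo (mid ∸ lo) (hi ∸ mid) I ⟩
  sweepFrom i lo (mid ∸ lo) (sweepFrom i (lo + (mid ∸ lo)) (hi ∸ mid) I)
    ≡⟨ cong (λ k → sweepFrom i lo (mid ∸ lo) (sweepFrom i k (hi ∸ mid) I)) (m+[n∸m]≡n lo≤mid) ⟩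
  sweepFrom i lo (mid ∸ lo) (sweepFrom i mid (hi ∸ mid) I) ∎
  where
  open ≡-Reasoning
  ∸-split : (mid ∸ lo) + (hi ∸ mid) ≡ hi ∸ lo
  ∸-split = trans (sym (+-∸-comm (hi ∸ mid) lo≤mid)) (cong (_∸ lo) (m+[n∸m]≡n mid≤hi))

sweep-join : ∀ {n} i {lo mid hi} {I K J : Subset n} → lo ≤ mid → mid ≤ hi →
             sweep i mid hi I ≗ K → sweep i lo mid K ≗ J → sweep i lo hi I ≗ J
sweep-join i {lo} {mid} {I = I} lo≤mid mid≤hi upper lower e rewrite sweep-split i I lo≤mid mid≤hi =
  trans (sweepFrom-cong i lo (mid ∸ lo) upper e) (lower e)

sweep-single : ∀ {n} i j (I : Subset n) → sweep i j (suc j) I ≗ toggleℕ i j I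
sweep-single i j I e rewrite m+n∸n≡m 1 j = refl

sweep-telescope : ∀ {n} i {lo hi} (S : ℕ → Subset n) → lo ≤ hi →
                  (∀ j → lo ≤ j → j < hi → toggleℕ i j (S (suc j)) ≗ S j) → sweep i lo hi (S hi) ≗ S lo
sweep-telescope i {lo} {hi} S lo≤hi step =
  subst (λ k → sweep i lo hi (S k) ≗ S lo) (m+[n∸m]≡n lo≤hi)
        (go lo (hi ∸ lo) (λ j lo≤j j<top → step j lo≤j (subst (j <_) (m+[n∸m]≡n lo≤hi) j<top)))
  where
  go : ∀ lo m → (∀ j → lo ≤ j → j < lo + m → toggleℕ i j (S (suc j)) ≗ S j) →
       sweepFrom i lo m (S (lo + m)) ≗ S lo
  go lo zero    _    rewrite +-identityʳ lo = λ _ → refl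
  go lo (suc m) step′ rewrite +-suc lo m = λ e →
    trans (toggleℕ-cong i lo (go (suc lo) m (λ j lo<j → step′ j (<⇒≤ lo<j))) e)
          (step′ lo ≤-refl (s≤s (m≤m+n lo m)) e)

sweep-blocked : ∀ {n} i {lo hi} (I : Subset n) → lo ≤ hi →
                (∀ j → lo ≤ j → j < hi → ¬ IsICS (flipℕ i j I)) → sweep i lo hi I ≗ I
sweep-blocked i I lo≤hi blocked =
  sweep-telescope i (λ _ → I) lo≤hi λ j lo≤j j<hi → toggleℕ-blocked i j (blocked j lo≤j j<hi)

toggles : ∀ {n} → List (Elt n) → Subset n → Subset n
toggles = foldr (λ x f → toggle x ∘ f) id

toggles-++ : ∀ {n} (xs ys : List (Elt n)) I → toggles (xs ++ ys) I ≡ toggles xs (toggles ys I)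
toggles-++ []       ys I = refl
toggles-++ (x ∷ xs) ys I = cong (toggle x) (toggles-++ xs ys I)

toggleAll : ∀ {n} → Fin 2 → List ℕ → Subset n → Subset n
toggleAll i = foldr (λ j f → toggleℕ i j ∘ f) id

toggles-row : ∀ {n} i (js : List (Fin n)) I → toggles (map (i ,_) js) I ≡ toggleAll i (map toℕ js) I
toggles-row i []       I = refl
toggles-row i (j ∷ js) I = cong (toggleℕ i (toℕ j)) (toggles-row i js I)

toggleAll-tabulate : ∀ {n} i lo m (I : Subset n) →
                     toggleAll i (tabulate {n = m} (λ k → lo + toℕ k)) I ≡ sweepFrom i lo m I
toggleAll-tabulate i lo zero    I = refl
toggleAll-tabulate i lo (suc m) I = begin
  toggleℕ i (lo + 0) (toggleAll i (tabulate {n = m} (λ k → lo + suc (toℕ k))) I)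
    ≡⟨ cong₂ (λ j js → toggleℕ i j (toggleAll i js I))
             (+-identityʳ lo) (tabulate-cong {n = m} (λ k → +-suc lo (toℕ k))) ⟩
  toggleℕ i lo (toggleAll i (tabulate {n = m} (λ k → suc lo + toℕ k)) I)
    ≡⟨ cong (toggleℕ i lo) (toggleAll-tabulate i (suc lo) m I) ⟩
  toggleℕ i lo (sweepFrom i (suc lo) m I) ∎
  where open ≡-Reasoning

toggles-wholeRow : ∀ {n} i (I : Subset n) → toggles (map (i ,_) (allFin n)) I ≡ sweep i 0 n I
toggles-wholeRow {n} i I = begin
  toggles (map (i ,_) (allFin n)) I    ≡⟨ toggles-row i (allFin n) I ⟩
  toggleAll i (map toℕ (allFin n)) I   ≡⟨ cong (λ js → toggleAll i js I) (map-tabulate {n = n} id toℕ) ⟩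
  toggleAll i (tabulate {n = n} toℕ) I ≡⟨ toggleAll-tabulate i 0 n I ⟩
  sweep i 0 n I                        ∎
  where open ≡-Reasoning

Row-sweeps : ∀ {n} (I : Subset n) → Row I ≡ sweep zero 0 n (sweep (suc zero) 0 n I)
Row-sweeps {n} I = begin
  toggles (lowerRow ++ upperRow ++ []) I        ≡⟨ toggles-++ lowerRow (upperRow ++ []) I ⟩
  toggles lowerRow (toggles (upperRow ++ []) I) ≡⟨ cong (λ xs → toggles lowerRow (toggles xs I)) (++-identityʳ upperRow) ⟩
  toggles lowerRow (toggles upperRow I)         ≡⟨ cong (toggles lowerRow) (toggles-wholeRow (suc zero) I) ⟩
  toggles lowerRow (sweep (suc zero) 0 n I)     ≡⟨ toggles-wholeRow zero _ ⟩
  sweep zero 0 n (sweep (suc zero) 0 n I)       ∎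
  where
  open ≡-Reasoning
  lowerRow upperRow : List (Elt n)
  lowerRow = map (zero ,_) (allFin n)
  upperRow = map (suc zero ,_) (allFin n)

Row-cong : ∀ {n} {I J : Subset n} → I ≗ J → Row I ≗ Row J
Row-cong {n} {I} {J} I≗J e rewrite Row-sweeps I | Row-sweeps J =
  sweepFrom-cong zero 0 n (sweepFrom-cong (suc zero) 0 n I≗J) e

Row-by-sweeps : ∀ {n} {I K J : Subset n} → sweep (suc zero) 0 n I ≗ K → sweep zero 0 n K ≗ J → Row I ≗ J
Row-by-sweeps {n} {I} upper lower e rewrite Row-sweeps I = trans (sweepFrom-cong zero 0 n upper e) (lower e)

-- Sets with one interval in each row

-- `intervals u₁ u₂ l₁ l₂` has upper row [u₁, u₂) and lower row [l₁, l₂), in 0-based positions.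
intervals : ∀ {n} → ℕ → ℕ → ℕ → ℕ → Subset n
intervals u₁ u₂ l₁ l₂ (zero  , j) = [ l₁ , l₂ ⟩ (toℕ j)
intervals u₁ u₂ l₁ l₂ (suc _ , j) = [ u₁ , u₂ ⟩ (toℕ j)

intervals-lowerEmpty : ∀ {n u₁ u₂} e e′ → intervals {n} u₁ u₂ e e ≗ intervals u₁ u₂ e′ e′
intervals-lowerEmpty e e′ (zero  , j) = trans ([,⟩-empty ≤-refl) (sym ([,⟩-empty ≤-refl))
intervals-lowerEmpty e e′ (suc _ , j) = refl

-- A lower point below an upper point spans an interval containing both rows between them,
-- so when neither row is empty and they are not apart, the staircase shape is forced.
data Compatible (u₁ u₂ l₁ l₂ : ℕ) : Set where
  upper-empty : u₂ ≤ u₁ → Compatible u₁ u₂ l₁ l₂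
  lower-empty : l₂ ≤ l₁ → Compatible u₁ u₂ l₁ l₂
  apart       : u₂ ≤ l₁ → Compatible u₁ u₂ l₁ l₂
  staircase   : u₁ ≤ l₁ → u₂ ≤ l₂ → Compatible u₁ u₂ l₁ l₂

Compatible-cross : ∀ {u₁ u₂ l₁ l₂ a b} → Compatible u₁ u₂ l₁ l₂ →
                   T ([ l₁ , l₂ ⟩ a) → T ([ u₁ , u₂ ⟩ b) → a ≤ b → u₁ ≤ l₁ × u₂ ≤ l₂
Compatible-cross (upper-empty u₂≤u₁) _ b∈ _ =
  ⊥-elim (<⇒≱ (≤-<-trans (proj₁ ([,⟩-elim b∈)) (proj₂ ([,⟩-elim b∈))) u₂≤u₁)
Compatible-cross (lower-empty l₂≤l₁) a∈ _ _ =
  ⊥-elim (<⇒≱ (≤-<-trans (proj₁ ([,⟩-elim a∈)) (proj₂ ([,⟩-elim a∈))) l₂≤l₁)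
Compatible-cross (apart u₂≤l₁) a∈ b∈ a≤b =
  ⊥-elim (<⇒≱ (≤-<-trans (≤-trans (proj₁ ([,⟩-elim a∈)) a≤b) (proj₂ ([,⟩-elim b∈))) u₂≤l₁)
Compatible-cross (staircase u₁≤l₁ u₂≤l₂) _ _ _ = u₁≤l₁ , u₂≤l₂

intervals-isICS : ∀ {n u₁ u₂ l₁ l₂} → Compatible u₁ u₂ l₁ l₂ → IsICS (intervals {n} u₁ u₂ l₁ l₂)
intervals-isICS {n} {u₁} {u₂} {l₁} {l₂} compat = isICS-intro _ closed
  where
  between : ∀ {a b c} → T ([ l₁ , l₂ ⟩ a) → T ([ u₁ , u₂ ⟩ b) → a ≤ c → c ≤ b →
            T ([ l₁ , l₂ ⟩ c) × T ([ u₁ , u₂ ⟩ c)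
  between {c = c} a∈ b∈ a≤c c≤b with Compatible-cross compat a∈ b∈ (≤-trans a≤c c≤b)
  ... | u₁≤l₁ , u₂≤l₂ =
    [,⟩-intro (l₁≤c , <-≤-trans c<u₂ u₂≤l₂) , [,⟩-intro (≤-trans u₁≤l₁ l₁≤c , c<u₂)
    where
    l₁≤c : l₁ ≤ c
    l₁≤c = ≤-trans (proj₁ ([,⟩-elim a∈)) a≤c
    c<u₂ : c < u₂
    c<u₂ = ≤-<-trans c≤b (proj₂ ([,⟩-elim b∈))
  closed : ∀ x y z → T (intervals {n} u₁ u₂ l₁ l₂ x) → T (intervals u₁ u₂ l₁ l₂ y) →
           T (x ≤P z) → T (z ≤P y) → T (intervals u₁ u₂ l₁ l₂ z)
  closed (zero , a) (zero , b) (zero , c) a∈ b∈ a≤c c≤b =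
    [,⟩-convex a∈ b∈ (≤ᵇ⇒≤ (toℕ a) (toℕ c) a≤c) (≤ᵇ⇒≤ (toℕ c) (toℕ b) c≤b)
  closed (suc zero , a) (suc zero , b) (suc zero , c) a∈ b∈ a≤c c≤b =
    [,⟩-convex a∈ b∈ (≤ᵇ⇒≤ (toℕ a) (toℕ c) a≤c) (≤ᵇ⇒≤ (toℕ c) (toℕ b) c≤b)
  closed (zero , a) (suc zero , b) (zero , c) a∈ b∈ a≤c c≤b =
    proj₁ (between a∈ b∈ (≤ᵇ⇒≤ (toℕ a) (toℕ c) a≤c) (≤ᵇ⇒≤ (toℕ c) (toℕ b) c≤b))
  closed (zero , a) (suc zero , b) (suc zero , c) a∈ b∈ a≤c c≤b =
    proj₂ (between a∈ b∈ (≤ᵇ⇒≤ (toℕ a) (toℕ c) a≤c) (≤ᵇ⇒≤ (toℕ c) (toℕ b) c≤b))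
  closed (suc _ , _) _ (zero , _) _ _ () _
  closed _ (zero , _) (suc _ , _) _ _ _ ()

intervals-crossing-¬isICS : ∀ {n u₁ l₁ l₂ v} → l₁ < l₂ → u₁ ≤ v → l₁ ≤ v → v < n → l₁ < u₁ ⊎ l₂ ≤ v →
                            ¬ IsICS (intervals {n} u₁ (suc v) l₁ l₂)
intervals-crossing-¬isICS {n} {u₁} {l₁} {l₂} {v} l₁<l₂ u₁≤v l₁≤v v<n gap ics
  with isICS⇒cross (intervals u₁ (suc v) l₁ l₂) ics (λ _ → refl) (λ _ → refl) v<n l₁≤v
         ([,⟩-in ≤-refl l₁<l₂) ([,⟩-in u₁≤v (n<1+n v))
... | l₁-up , v-low with gap
...   | inj₁ l₁<u₁ = not-¬ l₁-up ([,⟩-below l₁<u₁)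
...   | inj₂ l₂≤v  = not-¬ v-low ([,⟩-above l₂≤v)

focused : ∀ {n} → Fin 2 → ℕ → ℕ → ℕ → ℕ → Subset n
focused zero    c d p q = intervals c d p q
focused (suc _) c d p q = intervals p q c d

opaque
  unfolding flipRow

  focused-flip : ∀ {n} i c d {p q p′ q′ j} → flipRow j [ p , q ⟩ ≗ [ p′ , q′ ⟩ →
                 flipℕ i j (focused {n} i c d p q) ≗ focused i c d p′ q′
  focused-flip zero       c d flip (zero     , j′) = flip (toℕ j′)
  focused-flip zero       c d flip (suc zero , j′) = refl
  focused-flip (suc zero) c d flip (zero     , j′) = refl
  focused-flip (suc zero) c d flip (suc zero , j′) = flip (toℕ j′)

  focused-flip-row : ∀ {n} i c d p q j → RowOf (flipℕ i j (focused {n} i c d p q)) i (flipRow j [ p , q ⟩)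
  focused-flip-row zero       c d p q j j′ = refl
  focused-flip-row (suc zero) c d p q j j′ = refl

-- The positions j at which flipping (i, j) would break the nonempty interval [p, q) in two.
data OpensGap (n p q j : ℕ) : Set where
  gap-above  : p < q → q < j → j < n → OpensGap n p q j
  gap-below  : suc j < p → p < q → q ≤ n → OpensGap n p q j
  gap-inside : p < j → suc j < q → q ≤ n → OpensGap n p q j

flipRow-[,⟩-at : ∀ {p q j b} → [ p , q ⟩ j ≡ b → flipRow j [ p , q ⟩ j ≡ not b
flipRow-[,⟩-at {p} {q} {j} eq = trans (flipRow-at j [ p , q ⟩) (cong not eq)

flipRow-[,⟩-off : ∀ {p q j j′ b} → j ≢ j′ → [ p , q ⟩ j′ ≡ b → flipRow j [ p , q ⟩ j′ ≡ b
flipRow-[,⟩-off {p} {q} j≢j′ eq = trans (flipRow-off [ p , q ⟩ j≢j′) eq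

flipRow-¬convex : ∀ {n p q j} → OpensGap n p q j → ¬ RowConvex n (flipRow j [ p , q ⟩)
flipRow-¬convex (gap-above p<q q<j j<n) convex =
  not-¬ (convex j<n (<⇒≤ p<q) (<⇒≤ q<j)
           (flipRow-[,⟩-off (<⇒≢ (<-trans p<q q<j) ∘ sym) ([,⟩-in ≤-refl p<q))
           (flipRow-[,⟩-at ([,⟩-above (<⇒≤ q<j))))
        (flipRow-[,⟩-off (<⇒≢ q<j ∘ sym) ([,⟩-above ≤-refl))
flipRow-¬convex {j = j} (gap-below 1+j<p p<q q≤n) convex =
  not-¬ (convex (<-≤-trans p<q q≤n) (n≤1+n j) (<⇒≤ 1+j<p)
           (flipRow-[,⟩-at ([,⟩-below (<-trans (n<1+n j) 1+j<p)))
           (flipRow-[,⟩-off (<⇒≢ (<-trans (n<1+n j) 1+j<p)) ([,⟩-in ≤-refl p<q)))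
        (flipRow-[,⟩-off (<⇒≢ (n<1+n j)) ([,⟩-below 1+j<p))
flipRow-¬convex {q = suc w} {j} (gap-inside p<j 1+j<q q≤n) convex =
  not-¬ (convex q≤n (<⇒≤ p<j) (<⇒≤ j<w)
           (flipRow-[,⟩-off (<⇒≢ p<j ∘ sym) ([,⟩-in ≤-refl (<-trans p<j (<-trans j<w (n<1+n w)))))
           (flipRow-[,⟩-off (<⇒≢ j<w) ([,⟩-in (<⇒≤ (<-trans p<j j<w)) (n<1+n w))))
        (flipRow-[,⟩-at ([,⟩-in (<⇒≤ p<j) (<-trans j<w (n<1+n w))))
  where
  j<w : j < w
  j<w = s≤s⁻¹ 1+j<q

focused-flip-gap-¬isICS : ∀ {n} i c d {p q j} → OpensGap n p q j → ¬ IsICS (flipℕ i j (focused {n} i c d p q))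
focused-flip-gap-¬isICS i c d {p} {q} {j} gap ics =
  flipRow-¬convex gap (isICS⇒rowConvex (flipℕ i j (focused i c d p q)) i ics (focused-flip-row i c d p q j))

sweep-step : ∀ {n} i c d {p q p′ q′} j → flipRow j [ p , q ⟩ ≗ [ p′ , q′ ⟩ →
             IsICS (focused {n} i c d p′ q′) → sweep i j (suc j) (focused i c d p q) ≗ focused i c d p′ q′
sweep-step {n} i c d {p} {q} j flip ics e =
  trans (sweep-single i j (focused {n} i c d p q) e) (toggleℕ-applies i j (focused-flip {n} i c d flip) ics e)

sweep-step-blocked : ∀ {n} i c d {p q p′ q′} j → flipRow j [ p , q ⟩ ≗ [ p′ , q′ ⟩ →
                     ¬ IsICS (focused {n} i c d p′ q′) → sweep i j (suc j) (focused i c d p q) ≗ focused i c d p q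
sweep-step-blocked {n} i c d {p} {q} j flip ¬ics e =
  trans (sweep-single i j (focused {n} i c d p q) e)
        (toggleℕ-blocked i j (¬ics ∘ isICS-resp (focused-flip {n} i c d flip)) e)

sweep-gaps : ∀ {n} i c d p q {lo hi} → lo ≤ hi → (∀ j → lo ≤ j → j < hi → OpensGap n p q j) →
             sweep i lo hi (focused {n} i c d p q) ≗ focused i c d p q
sweep-gaps i c d p q lo≤hi gap =
  sweep-blocked i (focused i c d p q) lo≤hi λ j lo≤j j<hi → focused-flip-gap-¬isICS i c d (gap j lo≤j j<hi)

sweep-extendBottom : ∀ {n} i c d q {lo hi} → lo ≤ hi → hi ≤ q →
                     (∀ j → lo ≤ j → j < hi → IsICS (focused {n} i c d j q)) →
                     sweep i lo hi (focused {n} i c d hi q) ≗ focused i c d lo q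
sweep-extendBottom i c d q lo≤hi hi≤q ics = sweep-telescope i (λ k → focused i c d k q) lo≤hi λ j lo≤j j<hi →
  toggleℕ-applies i j (focused-flip i c d (flip-extendBottom (<-≤-trans j<hi hi≤q))) (ics j lo≤j j<hi)

sweep-shrinkTop : ∀ {n} i c d p {lo hi} → lo ≤ hi → p ≤ lo →
                  (∀ j → lo ≤ j → j < hi → IsICS (focused {n} i c d p j)) →
                  sweep i lo hi (focused {n} i c d p hi) ≗ focused i c d p lo
sweep-shrinkTop i c d p lo≤hi p≤lo ics = sweep-telescope i (λ k → focused i c d p k) lo≤hi λ j lo≤j j<hi →
  toggleℕ-applies i j (focused-flip i c d (flip-shrinkTop (≤-trans p≤lo lo≤j))) (ics j lo≤j j<hi)

-- Going down the row, the only toggles that keep [p, q) an interval are adding q and removing p.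
sweep-shift : ∀ {n} i c d {p q} → p < q → q < n →
              IsICS (focused {n} i c d p (suc q)) → IsICS (focused {n} i c d (suc p) (suc q)) →
              sweep i 0 n (focused {n} i c d p q) ≗ focused i c d (suc p) (suc q)
sweep-shift {n} i c d {p} {q} p<q q<n ics-top ics-bottom =
  sweep-join i z≤n q<n (sweep-gaps {n} i c d p q q<n λ j q<j j<n → gap-above p<q q<j j<n) (
  sweep-join i z≤n (n≤1+n q) (sweep-step {n} i c d q (flip-extendTop (<⇒≤ p<q)) ics-top) (
  sweep-join i z≤n p<q (sweep-gaps {n} i c d p (suc q) p<q λ j p<j j<q → gap-inside p<j (s≤s j<q) q<n) (
  sweep-join i z≤n (n≤1+n p) (sweep-step {n} i c d p (flip-shrinkBottom (m<n⇒m<1+n p<q)) ics-bottom) (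
  sweep-gaps {n} i c d (suc p) (suc q) z≤n λ j _ j<p → gap-below (s≤s j<p) (s≤s p<q) q<n))))

sweepUpper-shift : ∀ {n} l₁ l₂ {p q} → p < q → q < n →
                   Compatible p (suc q) l₁ l₂ → Compatible (suc p) (suc q) l₁ l₂ →
                   sweep (suc zero) 0 n (intervals {n} p q l₁ l₂) ≗ intervals (suc p) (suc q) l₁ l₂
sweepUpper-shift {n} l₁ l₂ p<q q<n top bottom =
  sweep-shift (suc zero) l₁ l₂ p<q q<n (intervals-isICS {n} top) (intervals-isICS {n} bottom)

sweepLower-shift : ∀ {n} u₁ u₂ {p q} → p < q → q < n →
                   Compatible u₁ u₂ p (suc q) → Compatible u₁ u₂ (suc p) (suc q) →
                   sweep zero 0 n (intervals {n} u₁ u₂ p q) ≗ intervals u₁ u₂ (suc p) (suc q)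
sweepLower-shift {n} u₁ u₂ p<q q<n top bottom =
  sweep-shift zero u₁ u₂ p<q q<n (intervals-isICS {n} top) (intervals-isICS {n} bottom)

-- Rowmotion on the shapes of the orbit

-- An upper point at a position j > m would lie above the lower point at m without the upper point at m.
sweepUpper-fill : ∀ {n m c} → m < c → c ≤ n →
                  sweep (suc zero) 0 n (intervals {n} (suc m) (suc m) m c) ≗ intervals 0 (suc m) m c
sweepUpper-fill {n} {m} {c} m<c c≤n =
  sweep-join (suc zero) z≤n m<n
    (sweep-blocked (suc zero) (intervals (suc m) (suc m) m c) m<n λ j m<j j<n →
       intervals-crossing-¬isICS m<c ≤-refl (<⇒≤ m<j) j<n (inj₁ m<j)
       ∘ isICS-resp (focused-flip {n} (suc zero) m c flip-empty))
    (sweep-extendBottom (suc zero) m c (suc m) z≤n ≤-refl λ j _ j≤m →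
       intervals-isICS {n} (staircase (s≤s⁻¹ j≤m) m<c))
  where
  m<n : m < n
  m<n = <-≤-trans m<c c≤n

sweepLower-clear : ∀ {n u b} → u ≤ b → b < n → sweep zero 0 n (intervals {n} u (suc b) b n) ≗ intervals u (suc b) b b
sweepLower-clear {n} {u} {b} u≤b b<n =
  sweep-join zero z≤n (<⇒≤ b<n)
    (sweep-shrinkTop zero u (suc b) b (<⇒≤ b<n) ≤-refl compatible)
    (sweep-blocked zero (intervals u (suc b) b b) z≤n λ j _ j<b →
       intervals-crossing-¬isICS (n<1+n j) u≤b (<⇒≤ j<b) b<n (inj₂ j<b)
       ∘ isICS-resp (focused-flip {n} zero u (suc b) flip-empty))
  where
  compatible : ∀ j → b ≤ j → j < n → IsICS (intervals {n} u (suc b) b j)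
  compatible j b≤j _ with m≤n⇒m<n∨m≡n b≤j
  ... | inj₁ b<j  = intervals-isICS {n} (staircase u≤b b<j)
  ... | inj₂ refl = intervals-isICS {n} (lower-empty ≤-refl)

Row-lowerOnly : ∀ {n m c} → m < c → c < n →
                Row (intervals {n} (suc m) (suc m) m c) ≗ intervals 0 (suc m) (suc m) (suc c)
Row-lowerOnly m<c c<n = Row-by-sweeps (sweepUpper-fill m<c (<⇒≤ c<n))
  (sweepLower-shift 0 _ m<c c<n (staircase z≤n (s≤s (<⇒≤ m<c))) (apart ≤-refl))

Row-lowerOnly-top : ∀ {n m} → m < n → Row (intervals {n} (suc m) (suc m) m n) ≗ intervals 0 (suc m) m m
Row-lowerOnly-top m<n = Row-by-sweeps (sweepUpper-fill m<n ≤-refl) (sweepLower-clear z≤n m<n)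

Row-staircase : ∀ {n a b c} → a < b → b < c → c < n →
                Row (intervals {n} a b b c) ≗ intervals (suc a) (suc b) (suc b) (suc c)
Row-staircase a<b b<c c<n = Row-by-sweeps
  (sweepUpper-shift _ _ a<b (<-trans b<c c<n) (staircase (<⇒≤ a<b) b<c) (staircase a<b b<c))
  (sweepLower-shift _ _ b<c c<n (staircase a<b (s≤s (<⇒≤ b<c))) (apart ≤-refl))

Row-staircase-top : ∀ {n a b} → a < b → b < n → Row (intervals {n} a b b n) ≗ intervals (suc a) (suc b) b b
Row-staircase-top a<b b<n = Row-by-sweeps
  (sweepUpper-shift _ _ a<b b<n (staircase (<⇒≤ a<b) b<n) (staircase a<b b<n))
  (sweepLower-clear a<b b<n)

Row-upperOnly : ∀ {n a b} e → a < b → b < n → Row (intervals {n} a b e e) ≗ intervals (suc a) (suc b) (suc a) n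
Row-upperOnly {n} {a} {b} e a<b b<n = Row-by-sweeps
  (sweepUpper-shift e e a<b b<n (lower-empty ≤-refl) (lower-empty ≤-refl))
  (λ x → trans (sweepFrom-cong zero 0 n (intervals-lowerEmpty e n) x) (lower x))
  where
  a+1<n : suc a < n
  a+1<n = ≤-<-trans a<b b<n
  lower : sweep zero 0 n (intervals {n} (suc a) (suc b) n n) ≗ intervals (suc a) (suc b) (suc a) n
  lower = sweep-join zero z≤n (<⇒≤ a+1<n)
    (sweep-extendBottom zero (suc a) (suc b) n (<⇒≤ a+1<n) ≤-refl λ j a<j _ → intervals-isICS {n} (staircase a<j b<n))
    (sweep-join zero z≤n (n≤1+n a)
      (sweep-step-blocked zero (suc a) (suc b) a (flip-extendBottom (<-trans (n<1+n a) a+1<n))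
        (intervals-crossing-¬isICS {n} {suc a} {a} {n} {b} (<-trans (n<1+n a) a+1<n) a<b (<⇒≤ a<b) b<n (inj₁ (n<1+n a))))
      (sweep-gaps zero (suc a) (suc b) (suc a) n z≤n λ j _ j<a → gap-below (s≤s j<a) a+1<n ≤-refl))

Row-alignedBottoms : ∀ {n a b} → a < b → b < n → Row (intervals {n} a b a n) ≗ intervals 0 (suc b) (suc a) (suc b)
Row-alignedBottoms {n} {a} {b} a<b b<n = Row-by-sweeps upper lower
  where
  a<n : a < n
  a<n = <-trans a<b b<n
  upper : sweep (suc zero) 0 n (intervals {n} a b a n) ≗ intervals 0 (suc b) a n
  upper =
    sweep-join (suc zero) z≤n b<n (sweep-gaps (suc zero) a n a b b<n λ j b<j j<n → gap-above a<b b<j j<n) (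
    sweep-join (suc zero) z≤n (n≤1+n b)
      (sweep-step (suc zero) a n b (flip-extendTop (<⇒≤ a<b)) (intervals-isICS {n} (staircase ≤-refl b<n))) (
    sweep-join (suc zero) z≤n a<b
      (sweep-gaps (suc zero) a n a (suc b) a<b λ j a<j j<b → gap-inside a<j (s≤s j<b) b<n) (
    sweep-join (suc zero) z≤n (n≤1+n a)
      (sweep-step-blocked (suc zero) a n a (flip-shrinkBottom (m<n⇒m<1+n a<b))
        (intervals-crossing-¬isICS {n} {suc a} {a} {n} {b} a<n a<b (<⇒≤ a<b) b<n (inj₁ (n<1+n a)))) (
    sweep-extendBottom (suc zero) a n (suc b) z≤n (<⇒≤ (m<n⇒m<1+n a<b)) λ j _ j<a →
      intervals-isICS {n} (staircase (<⇒≤ j<a) b<n)))))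
  lower : sweep zero 0 n (intervals {n} 0 (suc b) a n) ≗ intervals 0 (suc b) (suc a) (suc b)
  lower =
    sweep-join zero z≤n b<n
      (sweep-shrinkTop zero 0 (suc b) a b<n (<⇒≤ (m<n⇒m<1+n a<b)) λ j b<j _ → intervals-isICS {n} (staircase z≤n b<j)) (
    sweep-join zero z≤n (n≤1+n b)
      (sweep-step-blocked zero 0 (suc b) b (flip-shrinkTop (<⇒≤ a<b))
        (intervals-crossing-¬isICS {n} {0} {a} {b} {b} a<b z≤n (<⇒≤ a<b) b<n (inj₂ ≤-refl))) (
    sweep-join zero z≤n a<b
      (sweep-gaps zero 0 (suc b) a (suc b) a<b λ j a<j j<b → gap-inside a<j (s≤s j<b) b<n) (
    sweep-join zero z≤n (n≤1+n a)
      (sweep-step zero 0 (suc b) a (flip-shrinkBottom (m<n⇒m<1+n a<b)) (intervals-isICS {n} (staircase z≤n ≤-refl))) (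
    sweep-gaps zero 0 (suc b) (suc a) (suc b) z≤n λ j _ j<a → gap-below (s≤s j<a) (s≤s a<b) b<n))))

Row-alignedTops : ∀ {n a b} → a < b → b < n → Row (intervals {n} 0 b a b) ≗ intervals 0 0 (suc a) (suc b)
Row-alignedTops {n} {a} {b} a<b b<n = Row-by-sweeps upper
  (sweepLower-shift 0 0 a<b b<n (upper-empty ≤-refl) (upper-empty ≤-refl))
  where
  upper : sweep (suc zero) 0 n (intervals {n} 0 b a b) ≗ intervals 0 0 a b
  upper =
    sweep-join (suc zero) z≤n b<n
      (sweep-gaps (suc zero) a b 0 b b<n λ j b<j j<n → gap-above (≤-<-trans z≤n a<b) b<j j<n) (
    sweep-join (suc zero) z≤n (n≤1+n b)
      (sweep-step-blocked (suc zero) a b b (flip-extendTop z≤n)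
        (intervals-crossing-¬isICS {n} {0} {a} {b} {b} a<b z≤n (<⇒≤ a<b) b<n (inj₂ ≤-refl))) (
    sweep-shrinkTop (suc zero) a b 0 z≤n z≤n λ j _ j<b → intervals-isICS {n} (staircase z≤n (<⇒≤ j<b))))

-- The orbit

opaque
  unfolding [_,_⟩

  segment-lowerRow : ∀ {n} b i (j : Fin n) → segment b i (zero , j) ≡ [ b , b + i ⟩ (toℕ j)
  segment-lowerRow zero    i j = refl
  segment-lowerRow (suc b) i j = refl

segment≗intervals : ∀ {n} b i {u t} → b + i ≡ t → segment {n} b i ≗ intervals u u b t
segment≗intervals b i refl (zero  , j) = segment-lowerRow b i j
segment≗intervals b i refl (suc _ , j) = sym ([,⟩-empty ≤-refl)

upperRow-nonempty-¬LowICS : ∀ {n} {I : Subset n} {u₁ u₂ l₁ l₂} → I ≗ intervals u₁ u₂ l₁ l₂ →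
                            u₁ < u₂ → u₂ ≤ n → ¬ LowICS I
upperRow-nonempty-¬LowICS {n} {u₁ = u₁} {u₂} I≗ u₁<u₂ u₂≤n (_ , _ , lowerOnly) =
  not-¬ (trans (I≗ (suc zero , fromℕ< u₁<n)) u₁∈) (lowerOnly (fromℕ< u₁<n))
  where
  u₁<n : u₁ < n
  u₁<n = <-≤-trans u₁<u₂ u₂≤n
  u₁∈ : [ u₁ , u₂ ⟩ (toℕ (fromℕ< u₁<n)) ≡ true
  u₁∈ rewrite toℕ-fromℕ< u₁<n = [,⟩-in ≤-refl u₁<u₂

Row-reaches : ∀ {n} {I J K : Subset n} → I ≗ J → Row J ≗ K → Row I ≗ K
Row-reaches I≗J RowJ≗K e = trans (Row-cong I≗J e) (RowJ≗K e)

staircase-orbit : ∀ {n} a m y → 0 < y → a + m + y ≡ n → ∀ k → k < a →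
                  iterate (suc k) Row (segment {n} m y) ≗ intervals k (suc (k + m)) (suc (k + m)) (suc (k + m + y))
staircase-orbit a m y 0<y refl zero 0<a =
  Row-reaches (segment≗intervals m y refl) (Row-lowerOnly (m<m+n m 0<y) (+-monoˡ-< y (+-monoˡ-< m 0<a)))
staircase-orbit a m y 0<y refl (suc k) k<a =
  Row-reaches (staircase-orbit a m y 0<y refl k (<-trans (n<1+n k) k<a))
    (Row-staircase (s≤s (m≤m+n k m)) (s≤s (m<m+n (k + m) 0<y)) (+-monoˡ-< y (+-monoˡ-< m k<a)))

orbit-toUpperRow : ∀ {n} a m y → 0 < y → a + m + y ≡ n →
                   iterate (suc a) Row (segment {n} m y) ≗ intervals a (suc (a + m)) (a + m) (a + m)
orbit-toUpperRow zero m y 0<y refl =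
  Row-reaches (segment≗intervals m y refl) (Row-lowerOnly-top (m<m+n m 0<y))
orbit-toUpperRow (suc v) m y 0<y refl =
  Row-reaches (staircase-orbit (suc v) m y 0<y refl v ≤-refl)
    (Row-staircase-top (s≤s (m≤m+n v m)) (s≤s (m<m+n (v + m) 0<y)))

orbit-toUpperRow-¬LowICS : ∀ {n} a m y → 0 < y → a + m + y ≡ n →
                           ∀ k → k ≤ a → ¬ LowICS (iterate (suc k) Row (segment {n} m y))
orbit-toUpperRow-¬LowICS a m y 0<y refl k k≤a with m≤n⇒m<n∨m≡n k≤a
... | inj₁ k<a  = upperRow-nonempty-¬LowICS (staircase-orbit a m y 0<y refl k k<a) (s≤s (m≤m+n k m))
                    (<-≤-trans (+-monoˡ-< m k<a) (m≤m+n (a + m) y))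
... | inj₂ refl = upperRow-nonempty-¬LowICS (orbit-toUpperRow a m y 0<y refl) (s≤s (m≤m+n a m)) (m<m+n (a + m) 0<y)

orbit-fromUpperRow : ∀ {n} (I : Subset n) k {a b} e → a < b → suc (suc b) < n → iterate k Row I ≗ intervals a b e e →
                     (iterate (1 + k) Row I ≗ intervals (suc a) (suc b) (suc a) n)
                     × (iterate (2 + k) Row I ≗ intervals 0 (2 + b) (2 + a) (2 + b))
                     × (iterate (3 + k) Row I ≗ intervals 0 0 (3 + a) (3 + b))
orbit-fromUpperRow {n} I k {a} {b} e a<b b+2<n start = step₁ , step₂ , step₃
  where
  b+1<n : suc b < n
  b+1<n = <-trans (n<1+n _) b+2<n
  step₁ : iterate (1 + k) Row I ≗ intervals (suc a) (suc b) (suc a) n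
  step₁ = Row-reaches start (Row-upperOnly e a<b (<-trans (n<1+n _) b+1<n))
  step₂ : iterate (2 + k) Row I ≗ intervals 0 (2 + b) (2 + a) (2 + b)
  step₂ = Row-reaches step₁ (Row-alignedBottoms (s≤s a<b) b+1<n)
  step₃ : iterate (3 + k) Row I ≗ intervals 0 0 (3 + a) (3 + b)
  step₃ = Row-reaches step₂ (Row-alignedTops (s≤s (s≤s a<b)) b+2<n)

orbit-size : ∀ a m y n → suc m + y + suc (suc (suc (suc a))) ≡ n + 5 → a + m + y ≡ n
orbit-size a m y n sum = +-cancelʳ-≡ 5 (a + m + y) n (trans (rearrange a m y) sum)
  where
  rearrange : ∀ a m y → a + m + y + 5 ≡ suc m + y + suc (suc (suc (suc a)))
  rearrange = solve-∀

lemma3p16 : (n x y z : ℕ) → 4 ≤ x → 4 ≤ y → 4 ≤ z → x + y + z ≡ n + 5 →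
    ((e : Elt n) → iterate z Row (segment {n} (x ∸ 1) y) e ≡ segment {n} (z ∸ 1) x e)
    × ((k : ℕ) → 1 ≤ k → k ≤ z ∸ 1 → ¬ LowICS (iterate k Row (segment {n} (x ∸ 1) y)))
lemma3p16 n (suc m) y _ _ 4≤y (s≤s (s≤s (s≤s (s≤s {n = a} _)))) sum = reachesTarget , neverLow
  where
  0<y : 0 < y
  0<y = ≤-trans (s≤s z≤n) 4≤y
  size : a + m + y ≡ n
  size = orbit-size a m y n sum
  a+m+3<n : suc (suc (suc (a + m))) < n
  a+m+3<n = ≤-trans (≤-reflexive (+-comm 4 (a + m))) (≤-trans (+-monoʳ-≤ (a + m) 4≤y) (≤-reflexive size))
  final : (iterate (2 + a) Row (segment m y) ≗ intervals (suc a) (2 + (a + m)) (suc a) n)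
          × (iterate (3 + a) Row (segment m y) ≗ intervals 0 (3 + (a + m)) (2 + a) (3 + (a + m)))
          × (iterate (4 + a) Row (segment m y) ≗ intervals 0 0 (3 + a) (4 + (a + m)))
  final = orbit-fromUpperRow (segment m y) (suc a) (a + m) (s≤s (m≤m+n a m)) a+m+3<n (orbit-toUpperRow a m y 0<y size)
  reachesTarget : (e : Elt n) → iterate (4 + a) Row (segment m y) e ≡ segment (3 + a) (suc m) e
  reachesTarget e = trans (proj₂ (proj₂ final) e) (sym (segment≗intervals (3 + a) (suc m) (cong (3 +_) (+-suc a m)) e))
  neverLow : (k : ℕ) → 1 ≤ k → k ≤ 3 + a → ¬ LowICS (iterate k Row (segment m y))
  neverLow (suc k) _ k<a+3 with m≤n⇒m<n∨m≡n (s≤s⁻¹ k<a+3)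
  ... | inj₂ refl = upperRow-nonempty-¬LowICS (proj₁ (proj₂ final)) z<s (<⇒≤ a+m+3<n)
  ... | inj₁ k<a+2 with m≤n⇒m<n∨m≡n (s≤s⁻¹ k<a+2)
  ...   | inj₂ refl =
    upperRow-nonempty-¬LowICS (proj₁ final) (s≤s (s≤s (m≤m+n a m))) (<⇒≤ (<-trans (n<1+n _) a+m+3<n))
  ...   | inj₁ k<a+1 = orbit-toUpperRow-¬LowICS a m y 0<y size k (s≤s⁻¹ k<a+1)
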